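{- For every integer $k\geq4$, the Cayley digraph $\mathrm{Cay}(\mathbb{Z}_3\times\mathbb{Z}_{k+1},\{(1,1),(1,2),\ldots,(1,k)\})$ is weakly distance-regular.
   Context: $\mathrm{Cay}(G,S)$ for an abelian group $G$ and $S\subseteq G$ has vertex set $G$ and arcs $(x,y)$ with $y-x\in S$. $\partial(x,y)$ is the directed distance and $\tilde{\partial}(x,y)=(\partial(x,y),\partial(y,x))$. A digraph is weakly distance-regular if for all two-way distances $\tilde h,\tilde i,\tilde j$ occurring in it, the number of vertices $z$ with $\tilde\partial(x,z)=\tilde i$ and $\tilde\partial(z,y)=\tilde j$ depends only on $\tilde h=\tilde\partial(x,y)$. -}

module Defs where

open import Data.Nat using (ℕ; zero; suc; _+_; _∸_; _<_; _≤_; NonZero)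
open import Data.Nat.DivMod using (_mod_)
open import Data.Fin using (Fin; toℕ)
open import Data.Product using (Σ; _×_; _,_; ∃-syntax)
open import Data.Maybe using (Maybe; just; nothing)
open import Data.List using (List; length)
open import Data.List.Membership.Propositional using (_∈_)
open import Data.List.Relation.Unary.Unique.Propositional using (Unique)
open import Relation.Binary.PropositionalEquality using (_≡_)
open import Relation.Nullary using (¬_)
open import Function.Bundles using (_⇔_)

data Walk {V : Set} (Arc : V → V → Set) : V → V → ℕ → Set where
  here : ∀ {x} → Walk Arc x x 0
  step : ∀ {x y z n} → Arc x y → Walk Arc y z n → Walk Arc x z (suc n)

-- Directed distance ∂(x,y), with values in Maybe ℕ (nothing = ∞).
Dist : {V : Set} (Arc : V → V → Set) → V → V → Maybe ℕ → Set
Dist Arc x y (just d) = Walk Arc x y d × (∀ m → m < d → ¬ Walk Arc x y m)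
Dist Arc x y nothing  = ∀ m → ¬ Walk Arc x y m

TwoWay : {V : Set} (Arc : V → V → Set) → V → V → Maybe ℕ × Maybe ℕ → Set
TwoWay Arc x y (i , j) = Dist Arc x y i × Dist Arc y x j

-- "The number of elements z of V with P z is c":
-- a duplicate-free list of length c whose members are exactly those z.
HasCount : {V : Set} → (V → Set) → ℕ → Set
HasCount {V} P c = Σ (List V) λ zs → Unique zs × length zs ≡ c × (∀ z → (z ∈ zs) ⇔ P z)

WeaklyDistanceRegular : {V : Set} → (V → V → Set) → Set
WeaklyDistanceRegular {V} Arc =
  ∀ (h i j : Maybe ℕ × Maybe ℕ) (x y x' y' : V) →
  TwoWay Arc x y h → TwoWay Arc x' y' h → ∀ (c : ℕ) →
  HasCount (λ z → TwoWay Arc x z i × TwoWay Arc z y j) c →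
  HasCount (λ z → TwoWay Arc x' z i × TwoWay Arc z y' j) c

subMod : (n : ℕ) .{{_ : NonZero n}} → Fin n → Fin n → Fin n
subMod n a b = (toℕ a + (n ∸ toℕ b)) mod n

G : ℕ → Set
G k = Fin 3 × Fin (suc k)

_-G_ : ∀ {k} → G k → G k → G k
_-G_ {k} (a₁ , a₂) (b₁ , b₂) = subMod 3 a₁ b₁ , subMod (suc k) a₂ b₂

CayArc : ∀ {k} → (G k → Set) → G k → G k → Set
CayArc S x y = S (y -G x)

S₀ : (k : ℕ) → G k → Set
S₀ k g = ∃[ j ] (1 ≤ j × j ≤ k × g ≡ (1 mod 3 , j mod (suc k)))

{-# OPTIONS --safe #-}
-- An arc adds 1 to the ℤ₃-coordinate and changes the ℤ_{k+1}-coordinate arbitrarily, so a walk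
-- of length m shifts the first coordinate by m, and for m ≥ 2 it can end at any second
-- coordinate (intermediate values can avoid any two given ones once k + 1 ≥ 3). Hence
-- ∂((a, b), (a′, b′)) depends only on a′ − a and on whether b′ = b, and the two-way distance
-- determines both. Two pairs with the same data are related by an automorphism
-- (a, b) ↦ (a + c, π b), π a permutation, and automorphisms preserve the counts in the
-- definition of weak distance-regularity. The argument only needs k ≥ 2.
module Submission where

open import Defs
open import Data.Nat using (ℕ; _≤_; zero; suc; _+_; _*_; _∸_; _%_; z≤n; s≤s)
open import Data.Nat.Properties
  using (<-cmp; <⇒≤; <⇒≱; ≤-refl; ≤-reflexive; ≤-trans; ≤-pred; m≤m+n; n≢0⇒n>0;
         +-assoc; +-comm; *-suc; m+[n∸m]≡n; m∸n+n≡m)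
open import Data.Nat.DivMod using (_mod_; m<n⇒m%n≡m; [m+n]%n≡m%n; n%n≡0; m%n%n≡m%n; %-distribˡ-+)
open import Data.Fin using (Fin; zero; suc; toℕ)
open import Data.Fin.Properties using (toℕ-fromℕ<; toℕ<n; toℕ-injective; all?; _≟_)
open import Data.Fin.Permutation using (Permutation′; _⟨$⟩ʳ_; _⟨$⟩ˡ_; inverseˡ; inverseʳ; flip; transpose; _∘ₚ_)
open import Data.Product using (Σ; _×_; _,_; proj₁; proj₂; ∃-syntax)
open import Data.Product.Function.NonDependent.Propositional using (_×-⇔_)
open import Data.Maybe using (Maybe; just; nothing)
open import Data.Bool using (Bool; true; false)
open import Data.Empty using (⊥-elim)
open import Data.List using (map)
open import Data.List.Membership.Propositional using (_∈_)
open import Data.List.Properties using (length-map)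
open import Data.List.Membership.Propositional.Properties using (∈-map⁺; ∈-map⁻)
open import Data.List.Relation.Unary.Unique.Propositional.Properties using (map⁺)
open import Function using (_∘_; const)
open import Function.Bundles using (_⇔_; mk⇔; Equivalence)
open import Relation.Binary.Definitions using (tri<; tri≈; tri>)
open import Relation.Binary.PropositionalEquality
open import Relation.Nullary using (Dec; yes; no; does; proof)
open import Relation.Nullary.Decidable using (map′; dec-true; dec-false)
open import Relation.Nullary.Decidable.Core using (from-yes)
open import Relation.Nullary.Reflects using (Reflects; ofʸ; ofⁿ)

open Equivalence using (to; from)

module _ {V : Set} {Arc : V → V → Set} where

  Walk-map : (f : V → V) → (∀ {x y} → Arc x y → Arc (f x) (f y)) →
             ∀ {x y n} → Walk Arc x y n → Walk Arc (f x) (f y) n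
  Walk-map f f-arc here       = here
  Walk-map f f-arc (step a w) = step (f-arc a) (Walk-map f f-arc w)

  Dist-unique : ∀ {x y d d′} → Dist Arc x y d → Dist Arc x y d′ → d ≡ d′
  Dist-unique {d = nothing} {nothing} _       _        = refl
  Dist-unique {d = nothing} {just d′} no-walk (w′ , _) = ⊥-elim (no-walk d′ w′)
  Dist-unique {d = just d}  {nothing} (w , _) no-walk  = ⊥-elim (no-walk d w)
  Dist-unique {d = just d}  {just d′} (w , min) (w′ , min′) with <-cmp d d′
  ... | tri< d<d′ _ _ = ⊥-elim (min′ d d<d′ w)
  ... | tri≈ _ d≡d′ _ = cong just d≡d′
  ... | tri> _ _ d′<d = ⊥-elim (min d′ d′<d w′)

  TwoWay-unique : ∀ {x y h h′} → TwoWay Arc x y h → TwoWay Arc x y h′ → h ≡ h′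
  TwoWay-unique (p , q) (p′ , q′) = cong₂ _,_ (Dist-unique p p′) (Dist-unique q q′)

HasCount-map : ∀ {V : Set} {P Q : V → Set} {c} (f g : V → V) →
               (∀ v → g (f v) ≡ v) → (∀ v → f (g v) ≡ v) → (∀ v → P v ⇔ Q (f v)) →
               HasCount P c → HasCount Q c
HasCount-map {Q = Q} f g g∘f f∘g P⇔Q∘f (zs , unique , len , mem) =
  map f zs , map⁺ f-injective unique , trans (length-map f zs) len , λ v → mk⇔ (∈⇒Q v) (Q⇒∈ v)
  where
  f-injective : ∀ {u v} → f u ≡ f v → u ≡ v
  f-injective {u} {v} eq = trans (sym (g∘f u)) (trans (cong g eq) (g∘f v))

  ∈⇒Q : ∀ v → v ∈ map f zs → Q v
  ∈⇒Q v v∈ with ∈-map⁻ f v∈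
  ... | u , u∈zs , refl = to (P⇔Q∘f u) (to (mem u) u∈zs)

  Q⇒∈ : ∀ v → Q v → v ∈ map f zs
  Q⇒∈ v Qv = subst (_∈ map f zs) (f∘g v)
    (∈-map⁺ f (from (mem (g v)) (from (P⇔Q∘f (g v)) (subst Q (sym (f∘g v)) Qv))))

record Automorphism {V : Set} (Arc : V → V → Set) : Set where
  field
    to-vertex   : V → V
    from-vertex : V → V
    from∘to     : ∀ v → from-vertex (to-vertex v) ≡ v
    to∘from     : ∀ v → to-vertex (from-vertex v) ≡ v
    to-arc      : ∀ {x y} → Arc x y → Arc (to-vertex x) (to-vertex y)
    from-arc    : ∀ {x y} → Arc x y → Arc (from-vertex x) (from-vertex y)

  Walk⇔ : ∀ {x y n} → Walk Arc x y n ⇔ Walk Arc (to-vertex x) (to-vertex y) n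
  Walk⇔ {x} {y} {n} = mk⇔ (Walk-map to-vertex to-arc)
    (subst₂ (λ u v → Walk Arc u v n) (from∘to x) (from∘to y) ∘ Walk-map from-vertex from-arc)

  Dist⇔ : ∀ {x y} d → Dist Arc x y d ⇔ Dist Arc (to-vertex x) (to-vertex y) d
  Dist⇔ (just d) = mk⇔
    (λ (w , min) → to Walk⇔ w , λ m m<d → min m m<d ∘ from Walk⇔)
    (λ (w , min) → from Walk⇔ w , λ m m<d → min m m<d ∘ to Walk⇔)
  Dist⇔ nothing = mk⇔ (λ none m → none m ∘ from Walk⇔) (λ none m → none m ∘ to Walk⇔)

  TwoWay⇔ : ∀ {x y} h → TwoWay Arc x y h ⇔ TwoWay Arc (to-vertex x) (to-vertex y) h
  TwoWay⇔ (i , j) = Dist⇔ i ×-⇔ Dist⇔ j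

TwoWayDistanceTransitive : {V : Set} → (V → V → Set) → Set
TwoWayDistanceTransitive {V} Arc =
  ∀ {h} {x y x′ y′ : V} → TwoWay Arc x y h → TwoWay Arc x′ y′ h →
  Σ (Automorphism Arc) λ φ → Automorphism.to-vertex φ x ≡ x′ × Automorphism.to-vertex φ y ≡ y′

TwoWayDistanceTransitive⇒WeaklyDistanceRegular : {V : Set} {Arc : V → V → Set} →
  TwoWayDistanceTransitive Arc → WeaklyDistanceRegular Arc
TwoWayDistanceTransitive⇒WeaklyDistanceRegular transitive h i j x y x′ y′ xy x′y′ c count
  with transitive xy x′y′
... | φ , refl , refl = HasCount-map to-vertex from-vertex from∘to to∘from
        (λ _ → TwoWay⇔ i ×-⇔ TwoWay⇔ j) count
  where open Automorphism φ

does-≡⇒⇔ : ∀ {P Q : Set} (p? : Dec P) (q? : Dec Q) → does p? ≡ does q? → P ⇔ Q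
does-≡⇒⇔ (yes p)  (yes q)  _  = mk⇔ (const q) (const p)
does-≡⇒⇔ (no ¬p) (no ¬q) _  = mk⇔ (⊥-elim ∘ ¬p) (⊥-elim ∘ ¬q)
does-≡⇒⇔ (yes _)  (no _)   ()
does-≡⇒⇔ (no _)   (yes _)  ()

avoid₂ : ∀ {k} → 2 ≤ k → (u v : Fin (suc k)) → ∃[ c ] (c ≢ u × c ≢ v)
avoid₂ (s≤s (s≤s _)) zero          zero          = suc zero , (λ ()) , (λ ())
avoid₂ (s≤s (s≤s _)) zero          (suc zero)    = suc (suc zero) , (λ ()) , (λ ())
avoid₂ (s≤s (s≤s _)) zero          (suc (suc _)) = suc zero , (λ ()) , (λ ())
avoid₂ (s≤s (s≤s _)) (suc zero)    zero          = suc (suc zero) , (λ ()) , (λ ())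
avoid₂ (s≤s (s≤s _)) (suc (suc _)) zero          = suc zero , (λ ()) , (λ ())
avoid₂ (s≤s (s≤s _)) (suc _)       (suc _)       = zero , (λ ()) , (λ ())

transpose-matchˡ : ∀ {n} (i j : Fin n) → transpose i j ⟨$⟩ʳ i ≡ j
transpose-matchˡ i j rewrite dec-true (i ≟ i) refl = refl

transpose-fix : ∀ {n} {i j k : Fin n} → k ≢ i → k ≢ j → transpose i j ⟨$⟩ʳ k ≡ k
transpose-fix {i = i} {j} {k} k≢i k≢j rewrite dec-false (k ≟ i) k≢i | dec-false (k ≟ j) k≢j = refl

⟨$⟩ʳ-injective : ∀ {n} (π : Permutation′ n) {i j} → π ⟨$⟩ʳ i ≡ π ⟨$⟩ʳ j → i ≡ j
⟨$⟩ʳ-injective π {i} {j} eq = trans (sym (inverseˡ π)) (trans (cong (π ⟨$⟩ˡ_) eq) (inverseˡ π))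

permutation-sending : ∀ {n} {u v u′ v′ : Fin n} → (v ≡ u ⇔ v′ ≡ u′) →
                      ∃[ π ] (π ⟨$⟩ʳ u ≡ u′ × π ⟨$⟩ʳ v ≡ v′)
permutation-sending {u = u} {v} {u′} {v′} same with v ≟ u
... | yes refl = transpose u u′ , transpose-matchˡ u u′ , trans (transpose-matchˡ u u′) (sym (to same refl))
... | no v≢u = τ ∘ₚ transpose (τ ⟨$⟩ʳ v) v′ , u↦u′ , transpose-matchˡ (τ ⟨$⟩ʳ v) v′
  where
  τ : Permutation′ _
  τ = transpose u u′

  u↦u′ : transpose (τ ⟨$⟩ʳ v) v′ ⟨$⟩ʳ (τ ⟨$⟩ʳ u) ≡ u′
  u↦u′ = trans (cong (transpose (τ ⟨$⟩ʳ v) v′ ⟨$⟩ʳ_) (transpose-matchˡ u u′)) (transpose-fix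
    (λ u′≡τv → v≢u (⟨$⟩ʳ-injective τ (trans (sym u′≡τv) (sym (transpose-matchˡ u u′)))))
    (λ u′≡v′ → v≢u (from same (sym u′≡v′))))

module _ {m : ℕ} where
  private
    n : ℕ
    n = suc m

  toℕ-mod : (i : Fin n) → toℕ i mod n ≡ i
  toℕ-mod i = toℕ-injective (trans (toℕ-fromℕ< _) (m<n⇒m%n≡m (toℕ<n i)))

  subMod-self : (b : Fin n) → subMod n b b ≡ zero
  subMod-self b = toℕ-injective (begin
    toℕ (subMod n b b)          ≡⟨ toℕ-fromℕ< _ ⟩
    (toℕ b + (n ∸ toℕ b)) % n   ≡⟨ cong (_% n) (m+[n∸m]≡n (<⇒≤ (toℕ<n b))) ⟩
    n % n                       ≡⟨ n%n≡0 n ⟩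
    0                           ∎)
    where open ≡-Reasoning

  subMod≡zero⇒≡ : (c b : Fin n) → subMod n c b ≡ zero → c ≡ b
  subMod≡zero⇒≡ c b c-b≡0 = toℕ-injective (begin
    toℕ c                                       ≡⟨ m<n⇒m%n≡m (toℕ<n c) ⟨
    toℕ c % n                                   ≡⟨ [m+n]%n≡m%n (toℕ c) n ⟨
    (toℕ c + n) % n                             ≡⟨ cong (λ t → (toℕ c + t) % n) (m∸n+n≡m (<⇒≤ (toℕ<n b))) ⟨
    (toℕ c + ((n ∸ toℕ b) + toℕ b)) % n         ≡⟨ cong (_% n) (+-assoc (toℕ c) (n ∸ toℕ b) (toℕ b)) ⟨
    (toℕ c + (n ∸ toℕ b) + toℕ b) % n           ≡⟨ %-distribˡ-+ (toℕ c + (n ∸ toℕ b)) (toℕ b) n ⟩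
    ((toℕ c + (n ∸ toℕ b)) % n + toℕ b % n) % n ≡⟨ cong (λ t → (t + toℕ b % n) % n) c-b%n≡0 ⟩
    toℕ b % n % n                               ≡⟨ m%n%n≡m%n (toℕ b) n ⟩
    toℕ b % n                                   ≡⟨ m<n⇒m%n≡m (toℕ<n b) ⟩
    toℕ b                                       ∎)
    where
    open ≡-Reasoning
    c-b%n≡0 : (toℕ c + (n ∸ toℕ b)) % n ≡ 0
    c-b%n≡0 = trans (sym (toℕ-fromℕ< _)) (cong toℕ c-b≡0)

next : Fin 3 → Fin 3
next zero             = suc zero
next (suc zero)       = suc (suc zero)
next (suc (suc zero)) = zero

rotate : ℕ → Fin 3 → Fin 3
rotate zero    a = a
rotate (suc r) a = next (rotate r a)

neg : Fin 3 → Fin 3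
neg zero             = zero
neg (suc zero)       = suc (suc zero)
neg (suc (suc zero)) = suc zero

offset : Fin 3 → Fin 3 → Fin 3
offset a b = subMod 3 b a

rotate-next : ∀ r a → rotate r (next a) ≡ next (rotate r a)
rotate-next zero    a = refl
rotate-next (suc r) a = cong next (rotate-next r a)

rotate-+ : ∀ r s a → rotate r (rotate s a) ≡ rotate (r + s) a
rotate-+ zero    s a = refl
rotate-+ (suc r) s a = cong next (rotate-+ r s a)

rotate-comm : ∀ r s a → rotate r (rotate s a) ≡ rotate s (rotate r a)
rotate-comm r s a = begin
  rotate r (rotate s a) ≡⟨ rotate-+ r s a ⟩
  rotate (r + s) a      ≡⟨ cong (λ t → rotate t a) (+-comm r s) ⟩
  rotate (s + r) a      ≡⟨ rotate-+ s r a ⟨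
  rotate s (rotate r a) ∎
  where open ≡-Reasoning

rotate-3 : ∀ a → rotate 3 a ≡ a
rotate-3 zero             = refl
rotate-3 (suc zero)       = refl
rotate-3 (suc (suc zero)) = refl

rotate-*3 : ∀ q a → rotate (q * 3) a ≡ a
rotate-*3 zero    a = refl
rotate-*3 (suc q) a = trans (rotate-3 (rotate (q * 3) a)) (rotate-*3 q a)

rotate-inverse : ∀ r a → rotate (r * 2) (rotate r a) ≡ a
rotate-inverse r a = begin
  rotate (r * 2) (rotate r a) ≡⟨ rotate-+ (r * 2) r a ⟩
  rotate (r * 2 + r) a        ≡⟨ cong (λ t → rotate t a) (trans (+-comm (r * 2) r) (sym (*-suc r 2))) ⟩
  rotate (r * 3) a            ≡⟨ rotate-*3 r a ⟩
  a                           ∎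
  where open ≡-Reasoning

rotate-offset : ∀ a b → rotate (toℕ (offset a b)) a ≡ b
rotate-offset = from-yes (all? λ a → all? λ b → rotate (toℕ (offset a b)) a ≟ b)

offset-next : ∀ a b → offset a (next b) ≡ next (offset a b)
offset-next = from-yes (all? λ a → all? λ b → offset a (next b) ≟ next (offset a b))

offset-swap : ∀ a b → offset b a ≡ neg (offset a b)
offset-swap = from-yes (all? λ a → all? λ b → offset b a ≟ neg (offset a b))

offset-rotate : ∀ r a → offset a (rotate r a) ≡ rotate r zero
offset-rotate zero    a = subMod-self a
offset-rotate (suc r) a = trans (offset-next a (rotate r a)) (cong next (offset-rotate r a))

module Cayley (k : ℕ) where

  Arc : G k → G k → Set
  Arc = CayArc (S₀ k)

  Step : G k → G k → Set
  Step (a , b) (a′ , b′) = a′ ≡ next a × b′ ≢ b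

  Arc⇔Step : ∀ {x y} → Arc x y ⇔ Step x y
  Arc⇔Step {a , b} {a′ , b′} = mk⇔ arc⇒step step⇒arc
    where
    arc⇒step : Arc (a , b) (a′ , b′) → Step (a , b) (a′ , b′)
    arc⇒step (j , 1≤j , j≤k , eq) =
        trans (sym (rotate-offset a a′)) (cong (λ o → rotate (toℕ o) a) (cong proj₁ eq))
      , λ b′≡b → <⇒≱ 1≤j (≤-reflexive (j≡0 b′≡b))
      where
      j≡0 : b′ ≡ b → j ≡ 0
      j≡0 refl = begin
        j                        ≡⟨ m<n⇒m%n≡m (s≤s j≤k) ⟨
        j % suc k                ≡⟨ toℕ-fromℕ< _ ⟨
        toℕ (j mod suc k)        ≡⟨ cong (toℕ ∘ proj₂) eq ⟨
        toℕ (subMod (suc k) b b) ≡⟨ cong toℕ (subMod-self b) ⟩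
        0                        ∎
        where open ≡-Reasoning

    step⇒arc : Step (a , b) (a′ , b′) → Arc (a , b) (a′ , b′)
    step⇒arc (refl , b′≢b) =
      toℕ s , 1≤s , ≤-pred (toℕ<n s) , cong₂ _,_ (offset-rotate 1 a) (sym (toℕ-mod s))
      where
      s : Fin (suc k)
      s = subMod (suc k) b′ b
      1≤s : 1 ≤ toℕ s
      1≤s = n≢0⇒n>0 (b′≢b ∘ subMod≡zero⇒≡ b′ b ∘ toℕ-injective)

  Walk⇒rotate : ∀ {x y m} → Walk Arc x y m → proj₁ y ≡ rotate m (proj₁ x)
  Walk⇒rotate here = refl
  Walk⇒rotate {x} (step {y = z} {n = m} xz w) = begin
    _                         ≡⟨ Walk⇒rotate w ⟩
    rotate m (proj₁ z)        ≡⟨ cong (rotate m) (proj₁ (to (Arc⇔Step {x} {z}) xz)) ⟩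
    rotate m (next (proj₁ x)) ≡⟨ rotate-next m (proj₁ x) ⟩
    rotate (suc m) (proj₁ x)  ∎
    where open ≡-Reasoning

  Reach : G k → G k → ℕ → Set
  Reach x y zero            = x ≡ y
  Reach x y (suc zero)      = Step x y
  Reach x y m@(suc (suc _)) = proj₁ y ≡ rotate m (proj₁ x)

  Walk⇒Reach : ∀ {x y m} → Walk Arc x y m → Reach x y m
  Walk⇒Reach here                  = refl
  Walk⇒Reach (step xy here)        = to Arc⇔Step xy
  Walk⇒Reach w@(step _ (step _ _)) = Walk⇒rotate w

  prepend : ∀ {a b a′ b′ z m} → a′ ≡ next a → b′ ≢ b →
            Walk Arc (a′ , b′) z m → Walk Arc (a , b) z (suc m)
  prepend {a} {b} {a′} {b′} a′≡ b′≢b = step (from (Arc⇔Step {a , b} {a′ , b′}) (a′≡ , b′≢b))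

  Reach⇒Walk : 2 ≤ k → ∀ {x y} m → Reach x y m → Walk Arc x y m
  Reach⇒Walk _ zero refl = here
  Reach⇒Walk _ {x} {y} (suc zero) xy = step (from (Arc⇔Step {x} {y}) xy) here
  Reach⇒Walk 2≤k {a , b} {a′ , b′} 2 a′≡ =
    let c , c≢b , c≢b′ = avoid₂ 2≤k b b′
    in prepend refl c≢b (prepend a′≡ (c≢b′ ∘ sym) here)
  Reach⇒Walk 2≤k {a , b} (suc m@(suc (suc _))) y≡ =
    let c , c≢b , _ = avoid₂ 2≤k b b
    in prepend refl c≢b (Reach⇒Walk 2≤k m (trans y≡ (sym (rotate-next m a))))

  -- D a e is the distance from (c , b) to (c + a , b′), where e says whether b′ = b.
  D : Fin 3 → Bool → ℕ
  D zero             true  = 0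
  D zero             false = 3
  D (suc zero)       true  = 4
  D (suc zero)       false = 1
  D (suc (suc zero)) _     = 2

  Reach-D : ∀ {x y e} → Reflects (proj₂ y ≡ proj₂ x) e →
            Reach x y (D (offset (proj₁ x) (proj₁ y)) e)
  Reach-D {a , b} {a′ , b′} r with offset a a′ | rotate-offset a a′
  Reach-D {a , b} {.a , .b} (ofʸ refl) | zero           | refl = refl
  Reach-D {a , b} {.a , b′} (ofⁿ _)    | zero           | refl = sym (rotate-3 a)
  Reach-D {a , b} {._ , .b} (ofʸ refl) | suc zero       | refl = cong next (sym (rotate-3 a))
  Reach-D {a , b} {._ , b′} (ofⁿ b′≢b) | suc zero       | refl = refl , b′≢b
  Reach-D {a , b} {._ , b′} _          | suc (suc zero) | refl = refl

  D-rotate-≤ : ∀ m e → D (rotate (suc (suc m)) zero) e ≤ suc (suc m)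
  D-rotate-≤ zero          _     = ≤-refl
  D-rotate-≤ (suc zero)    true  = z≤n
  D-rotate-≤ (suc zero)    false = ≤-refl
  D-rotate-≤ (suc (suc m)) e     = ≤-trans (D≤4 (rotate (4 + m) zero) e) (m≤m+n 4 m)
    where
    D≤4 : ∀ a e → D a e ≤ 4
    D≤4 zero             true  = z≤n
    D≤4 zero             false = s≤s (s≤s (s≤s z≤n))
    D≤4 (suc zero)       true  = ≤-refl
    D≤4 (suc zero)       false = s≤s z≤n
    D≤4 (suc (suc zero)) _     = s≤s (s≤s z≤n)

  D-minimal : ∀ {x y e} m → Reflects (proj₂ y ≡ proj₂ x) e → Reach x y m →
              D (offset (proj₁ x) (proj₁ y)) e ≤ m
  D-minimal {a , _} zero (ofʸ _) refl = ≤-reflexive (cong (λ o → D o true) (subMod-self a))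
  D-minimal zero (ofⁿ b≢b) refl = ⊥-elim (b≢b refl)
  D-minimal (suc zero) (ofʸ b′≡b) (_ , b′≢b) = ⊥-elim (b′≢b b′≡b)
  D-minimal {a , _} (suc zero) (ofⁿ _) (refl , _) =
    ≤-reflexive (cong (λ o → D o false) (offset-rotate 1 a))
  D-minimal {a , _} {e = e} (suc (suc m)) _ refl =
    subst (λ o → D o e ≤ suc (suc m)) (sym (offset-rotate (suc (suc m)) a)) (D-rotate-≤ m e)

  dist : 2 ≤ k → ∀ {x y e} → Reflects (proj₂ y ≡ proj₂ x) e →
         Dist Arc x y (just (D (offset (proj₁ x) (proj₁ y)) e))
  dist 2≤k r = Reach⇒Walk 2≤k _ (Reach-D r) , λ m m<D w → <⇒≱ m<D (D-minimal m r (Walk⇒Reach w))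

  pairClass : G k → G k → Fin 3 × Bool
  pairClass (a , b) (a′ , b′) = offset a a′ , does (b′ ≟ b)

  twoWayDistance : G k → G k → Maybe ℕ × Maybe ℕ
  twoWayDistance (a , b) (a′ , b′) =
    just (D (offset a a′) (does (b′ ≟ b))) , just (D (offset a′ a) (does (b′ ≟ b)))

  TwoWay-twoWayDistance : 2 ≤ k → ∀ x y → TwoWay Arc x y (twoWayDistance x y)
  TwoWay-twoWayDistance 2≤k (a , b) (a′ , b′) =
    dist 2≤k (proof (b′ ≟ b)) , dist 2≤k (proof (map′ sym sym (b′ ≟ b)))

  -- Only the distance 2 is ambiguous; the reverse distance (4 or 1) then tells whether b′ = b.
  decode : Maybe ℕ × Maybe ℕ → Fin 3 × Bool
  decode (just 0 , _) = zero , true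
  decode (just 3 , _) = zero , false
  decode (just 4 , _) = suc zero , true
  decode (just 1 , _) = suc zero , false
  decode (_ , just 4) = suc (suc zero) , true
  decode _            = suc (suc zero) , false

  decode-D : ∀ a e → decode (just (D a e) , just (D (neg a) e)) ≡ (a , e)
  decode-D zero             true  = refl
  decode-D zero             false = refl
  decode-D (suc zero)       true  = refl
  decode-D (suc zero)       false = refl
  decode-D (suc (suc zero)) true  = refl
  decode-D (suc (suc zero)) false = refl

  decode-twoWayDistance : ∀ x y → decode (twoWayDistance x y) ≡ pairClass x y
  decode-twoWayDistance (a , b) (a′ , b′) rewrite offset-swap a a′ =
    decode-D (offset a a′) (does (b′ ≟ b))

  TwoWay⇒pairClass≡ : 2 ≤ k → ∀ {h x y x′ y′} → TwoWay Arc x y h → TwoWay Arc x′ y′ h →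
                      pairClass x y ≡ pairClass x′ y′
  TwoWay⇒pairClass≡ 2≤k {h} {x} {y} {x′} {y′} xy x′y′ = begin
    pairClass x y                 ≡⟨ decode-twoWayDistance x y ⟨
    decode (twoWayDistance x y)   ≡⟨ cong decode (TwoWay-unique (TwoWay-twoWayDistance 2≤k x y) xy) ⟩
    decode h                      ≡⟨ cong decode (TwoWay-unique x′y′ (TwoWay-twoWayDistance 2≤k x′ y′)) ⟩
    decode (twoWayDistance x′ y′) ≡⟨ decode-twoWayDistance x′ y′ ⟩
    pairClass x′ y′               ∎
    where open ≡-Reasoning

  shift : ℕ → Permutation′ (suc k) → G k → G k
  shift r π (a , b) = rotate r a , π ⟨$⟩ʳ b

  shift-Arc : ∀ r π {x y} → Arc x y → Arc (shift r π x) (shift r π y)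
  shift-Arc r π {a , b} {a′ , b′} xy with to (Arc⇔Step {a , b} {a′ , b′}) xy
  ... | refl , b′≢b = from (Arc⇔Step {shift r π (a , b)} {shift r π (a′ , b′)})
                        (rotate-next r a , b′≢b ∘ ⟨$⟩ʳ-injective π)

  shift-automorphism : ℕ → Permutation′ (suc k) → Automorphism Arc
  shift-automorphism r π = record
    { to-vertex   = shift r π
    ; from-vertex = shift (r * 2) (flip π)
    ; from∘to     = λ (a , b) → cong₂ _,_ (rotate-inverse r a) (inverseˡ π)
    ; to∘from     = λ (a , b) →
        cong₂ _,_ (trans (rotate-comm r (r * 2) a) (rotate-inverse r a)) (inverseʳ π)
    ; to-arc      = shift-Arc r π
    ; from-arc    = shift-Arc (r * 2) (flip π)
    }

  pairClass≡⇒automorphism : ∀ {x y x′ y′} → pairClass x y ≡ pairClass x′ y′ →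
    Σ (Automorphism Arc) λ φ → Automorphism.to-vertex φ x ≡ x′ × Automorphism.to-vertex φ y ≡ y′
  pairClass≡⇒automorphism {a , b} {c , d} {a′ , b′} {c′ , d′} same
    with permutation-sending (does-≡⇒⇔ (d ≟ b) (d′ ≟ b′) (cong proj₂ same))
  ... | π , πb , πd =
    shift-automorphism r π , cong₂ _,_ (rotate-offset a a′) πb , cong₂ _,_ rc≡c′ πd
    where
    r s : ℕ
    r = toℕ (offset a a′)
    s = toℕ (offset a c)
    rc≡c′ : rotate r c ≡ c′
    rc≡c′ = begin
      rotate r c                      ≡⟨ cong (rotate r) (rotate-offset a c) ⟨
      rotate r (rotate s a)           ≡⟨ rotate-comm r s a ⟩
      rotate s (rotate r a)           ≡⟨ cong (rotate s) (rotate-offset a a′) ⟩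
      rotate s a′                     ≡⟨ cong (λ o → rotate (toℕ o) a′) (cong proj₁ same) ⟩
      rotate (toℕ (offset a′ c′)) a′  ≡⟨ rotate-offset a′ c′ ⟩
      c′                              ∎
      where open ≡-Reasoning

  twoWayDistanceTransitive : 2 ≤ k → TwoWayDistanceTransitive Arc
  twoWayDistanceTransitive 2≤k xy x′y′ = pairClass≡⇒automorphism (TwoWay⇒pairClass≡ 2≤k xy x′y′)

proposition2p7 : (k : ℕ) → 4 ≤ k → WeaklyDistanceRegular (CayArc {k} (S₀ k))
proposition2p7 k 4≤k = TwoWayDistanceTransitive⇒WeaklyDistanceRegular (twoWayDistanceTransitive 2≤k)
  where
  open Cayley k
  2≤k : 2 ≤ k
  2≤k = ≤-trans (s≤s (s≤s z≤n)) 4≤k
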